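{- Let $G(P,H)$ be a positive point-halfplane incidence graph. Then the bipartite complement of $G(P,H)$ is also a positive point-halfplane incidence graph.
   Context: A halfplane is a set $h=\{x\in\mathbb{R}^2:\langle w_h,x\rangle\le t_h\}$ (or with strict inequality) with $w_h\neq0$, its normal vector. For a finite set $P$ of points and a finite set $H$ of halfplanes in $\mathbb{R}^2$, $G(P,H)$ is the bipartite graph with parts $P,H$ and edges $ph$ for $p\in h$. A bipartite graph is a positive point-halfplane incidence graph if it is isomorphic (as a bipartite graph, points to points and halfplanes to halfplanes) to some $G(P,H)$ in which the normal vectors of all halfplanes have pairwise non-negative dot products. The bipartite complement of a bipartite graph $(X,Y,E)$ is $(X,Y,(X\times Y)\setminus E)$.
   Formalization: Points and normal vectors lie in ℚ² instead of $\mathbb{R}^2$, and thresholds are rational, both for the given graph and for the realization of its bipartite complement. -}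

module Defs where

open import Data.Rational using (ℚ; 0ℚ; _+_; _*_; _≤_; _<_)
open import Data.Product using (_×_; _,_; Σ; proj₁; proj₂)
open import Data.Bool using (Bool; true; false)
open import Data.Nat using (ℕ)
open import Data.Fin using (Fin)
open import Function.Bundles using (_⇔_)
open import Relation.Nullary using (¬_)
open import Relation.Binary.PropositionalEquality using (_≡_)

Point : Set
Point = ℚ × ℚ

_·_ : Point → Point → ℚ
(a , b) · (c , d) = a * c + b * d

-- A halfplane {x : ⟨w,x⟩ ≤ t} (strict = false) or {x : ⟨w,x⟩ < t} (strict = true), w ≠ 0
record Halfplane : Set where
  field
    normal    : Point
    normal≢0  : ¬ (normal ≡ (0ℚ , 0ℚ))
    threshold : ℚ
    strict    : Bool

open Halfplane public

_∈ₕ_ : Point → Halfplane → Set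
x ∈ₕ h with strict h
... | true  = (normal h · x) < threshold h
... | false = (normal h · x) ≤ threshold h

SameSet : Halfplane → Halfplane → Set
SameSet h h′ = (x : Point) → (x ∈ₕ h) ⇔ (x ∈ₕ h′)

-- A bipartite graph with parts Fin m (points side) and Fin n (halfplanes side),
-- given by its edge relation.
BipGraph : ℕ → ℕ → Set₁
BipGraph m n = Fin m → Fin n → Set

complement : ∀ {m n} → BipGraph m n → BipGraph m n
complement E i j = ¬ E i j

-- E is a positive point-halfplane incidence graph: there are a set P of m distinct
-- points and a set H of n distinct halfplanes (indexed by the two parts, so the
-- indexing is the isomorphism) with pairwise non-negative normal dot products,
-- such that i ~ j in E iff point i lies in halfplane j.
record PositivePHIGraph {m n : ℕ} (E : BipGraph m n) : Set where
  field
    pt       : Fin m → Point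
    hp       : Fin n → Halfplane
    pt-inj   : ∀ i i′ → pt i ≡ pt i′ → i ≡ i′
    hp-inj   : ∀ j j′ → SameSet (hp j) (hp j′) → j ≡ j′
    positive : ∀ j j′ → 0ℚ ≤ (normal (hp j) · normal (hp j′))
    incid    : ∀ i j → E i j ⇔ (pt i ∈ₕ hp j)

{-# OPTIONS --safe #-}
-- The complement of the halfplane {x : ⟨w,x⟩ ≤ t} is the open halfplane {x : ⟨-w,x⟩ < -t},
-- and vice versa. Replacing every halfplane by its complement therefore complements the
-- incidence graph and negates all normal vectors, which leaves their pairwise dot products
-- unchanged. Distinct halfplanes stay distinct because membership is decidable, so a
-- halfplane is determined by its complement.
module Submission where

open import Defs
open import Data.Nat using (ℕ)
open import Data.Rational using (ℚ; 0ℚ; -_; _+_; _*_; _≤_; _<_)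
open import Data.Rational.Properties
  using (_≤?_; _<?_; <-irrefl; <-≤-trans; ≰⇒>; ≮⇒≥; neg-antimono-<; neg-antimono-≤; neg-injective;
         neg-distrib-+; neg-distribˡ-*; neg-distribʳ-*; +-*-ring)
open import Algebra.Properties.Ring +-*-ring using (-‿involutive)
open import Data.Product using (_,_; proj₁; proj₂)
open import Data.Bool using (true; false; not)
open import Function using (_∘_)
open import Function.Bundles using (_⇔_; mk⇔; Equivalence)
open import Function.Properties.Equivalence using () renaming (sym to ⇔-sym; trans to ⇔-trans)
open import Relation.Nullary using (¬_; Dec; contraposition)
open import Relation.Nullary.Decidable using (decidable-stable)
open import Relation.Binary.PropositionalEquality using (_≡_; _≢_; module ≡-Reasoning; refl; sym; cong; cong₂; subst)
open ≡-Reasoning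

open Equivalence using (to; from)

private
  variable
    p q : ℚ

<⇒≱ : p < q → ¬ (q ≤ p)
<⇒≱ p<q q≤p = <-irrefl refl (<-≤-trans p<q q≤p)

neg<neg⇔≰ : (- p < - q) ⇔ (¬ p ≤ q)
neg<neg⇔≰ = mk⇔ (λ -p<-q p≤q → <⇒≱ -p<-q (neg-antimono-≤ p≤q)) (neg-antimono-< ∘ ≰⇒>)

neg≤neg⇔≮ : (- p ≤ - q) ⇔ (¬ p < q)
neg≤neg⇔≮ = mk⇔ (λ -p≤-q p<q → <⇒≱ (neg-antimono-< p<q) -p≤-q) (neg-antimono-≤ ∘ ≮⇒≥)

¬-cong-⇔ : ∀ {a b} {A : Set a} {B : Set b} → A ⇔ B → (¬ A) ⇔ (¬ B)
¬-cong-⇔ A⇔B = mk⇔ (contraposition (from A⇔B)) (contraposition (to A⇔B))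

-ₚ_ : Point → Point
-ₚ (a , b) = (- a , - b)

-ₚ-≢0 : ∀ w → w ≢ (0ℚ , 0ℚ) → -ₚ w ≢ (0ℚ , 0ℚ)
-ₚ-≢0 w w≢0 -w≡0 =
  w≢0 (cong₂ _,_ (neg-injective (cong proj₁ -w≡0)) (neg-injective (cong proj₂ -w≡0)))

neg*neg : ∀ p q → - p * - q ≡ p * q
neg*neg p q = begin
  - p * - q     ≡⟨ neg-distribˡ-* p (- q) ⟨
  - (p * - q)   ≡⟨ cong -_ (neg-distribʳ-* p q) ⟨
  - (- (p * q)) ≡⟨ -‿involutive (p * q) ⟩
  p * q         ∎

·-negateˡ : ∀ w x → (-ₚ w) · x ≡ - (w · x)
·-negateˡ (a , b) (c , d) = begin
  - a * c + - b * d     ≡⟨ cong₂ _+_ (neg-distribˡ-* a c) (neg-distribˡ-* b d) ⟨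
  - (a * c) + - (b * d) ≡⟨ neg-distrib-+ (a * c) (b * d) ⟨
  - (a * c + b * d)     ∎

·-negate : ∀ w v → (-ₚ w) · (-ₚ v) ≡ w · v
·-negate (a , b) (c , d) = cong₂ _+_ (neg*neg a c) (neg*neg b d)

complementₕ : Halfplane → Halfplane
complementₕ h = record
  { normal    = -ₚ normal h
  ; normal≢0  = -ₚ-≢0 (normal h) (normal≢0 h)
  ; threshold = - threshold h
  ; strict    = not (strict h)
  }

∈-complementₕ : ∀ h x → (x ∈ₕ complementₕ h) ⇔ (¬ (x ∈ₕ h))
∈-complementₕ record { normal = w ; strict = false } x rewrite ·-negateˡ w x = neg<neg⇔≰
∈-complementₕ record { normal = w ; strict = true  } x rewrite ·-negateˡ w x = neg≤neg⇔≮

_∈ₕ?_ : ∀ x h → Dec (x ∈ₕ h)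
x ∈ₕ? record { normal = w ; threshold = t ; strict = false } = (w · x) ≤? t
x ∈ₕ? record { normal = w ; threshold = t ; strict = true  } = (w · x) <? t

complementₕ-antitone : ∀ h h′ →
  (∀ x → x ∈ₕ complementₕ h′ → x ∈ₕ complementₕ h) → ∀ x → x ∈ₕ h → x ∈ₕ h′
complementₕ-antitone h h′ c′⊆c x x∈h = decidable-stable (x ∈ₕ? h′) λ x∉h′ →
  to (∈-complementₕ h x) (c′⊆c x (from (∈-complementₕ h′ x) x∉h′)) x∈h

SameSet-complementₕ⁻¹ : ∀ h h′ → SameSet (complementₕ h) (complementₕ h′) → SameSet h h′
SameSet-complementₕ⁻¹ h h′ same x = mk⇔
  (complementₕ-antitone h h′ (λ y → from (same y)) x)
  (complementₕ-antitone h′ h (λ y → to (same y)) x)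

proposition4p8 : (m n : ℕ) (E : BipGraph m n) → PositivePHIGraph E → PositivePHIGraph (complement E)
proposition4p8 m n E G = record
  { pt       = pt
  ; hp       = complementₕ ∘ hp
  ; pt-inj   = pt-inj
  ; hp-inj   = λ j j′ → hp-inj j j′ ∘ SameSet-complementₕ⁻¹ (hp j) (hp j′)
  ; positive = λ j j′ → subst (0ℚ ≤_) (sym (·-negate (normal (hp j)) (normal (hp j′)))) (positive j j′)
  ; incid    = λ i j → ⇔-trans (¬-cong-⇔ (incid i j)) (⇔-sym (∈-complementₕ (hp j) (pt i)))
  }
  where open PositivePHIGraph G
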